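{- Let $P(z)=\sum_{n\ge0}p_nz^n$, where $p_n$ is the number of partial skew Motzkin paths of length $n$ (ending at any height; defined in the context). Let $W=\sqrt{1-4z+2z^2+z^4}$ with the branch having value $1$ at $z=0$. Then $$P(z)=\frac{2-3z-7z^2-z^3+z^4-(2+z)(1+z)W}{2z(1+z)(2z^2+3z-1)}.$$
   Context: A partial skew Motzkin path of length $n$ is a word $s_1s_2\cdots s_n$ over the four-letter alphabet $\{U,D,R,L\}$, where $U$ (up-step) has displacement $(1,1)$, $D$ (down-step) has displacement $(1,-1)$, $R$ (red step) also has displacement $(1,-1)$ but is a different letter from $D$, and $L$ (level step) has displacement $(1,0)$. The path starts at $(0,0)$; its height after $i$ steps is the sum of the vertical displacements of $s_1,\dots,s_i$. The conditions are: (i) the height never becomes negative; (ii) no $U$ is immediately followed by $R$, and no $R$ is immediately followed by $U$. The empty path counts as one path of length $0$. No condition is imposed on the final height. -}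

module Defs where

open import Data.Nat using (ℕ; zero; suc; _∸_)
open import Data.Bool using (Bool; true; false; _∧_; not)
open import Data.List using (List; []; _∷_; map; foldr; length; filter; inits; upTo; concatMap)
open import Data.List.Relation.Unary.All using (All)
open import Data.Integer using (ℤ; +_; -[1+_]; _≤ᵇ_) renaming (_+_ to _+ℤ_)
open import Data.Rational using (ℚ; 0ℚ; 1ℚ; _/_) renaming (_+_ to _+q_; _*_ to _*q_; -_ to -q_)
open import Relation.Nullary.Decidable using (does)

data Step : Set where
  U D R L : Step

disp : Step → ℤ
disp U = + 1
disp D = -[1+ 0 ]
disp R = -[1+ 0 ]
disp L = + 0

height : List Step → ℤ
height ws = foldr (λ s h → disp s +ℤ h) (+ 0) ws

allB : List Bool → Bool
allB = foldr _∧_ true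

nonNeg : List Step → Bool
nonNeg ws = allB (map (λ pre → + 0 ≤ᵇ height pre) (inits ws))

badPair : Step → Step → Bool
badPair U R = true
badPair R U = true
badPair _ _ = false

noBadPair : List Step → Bool
noBadPair [] = true
noBadPair (s ∷ []) = true
noBadPair (s ∷ t ∷ ws) = not (badPair s t) ∧ noBadPair (t ∷ ws)

isPSM : List Step → Bool
isPSM ws = nonNeg ws ∧ noBadPair ws

words : ℕ → List (List Step)
words zero = [] ∷ []
words (suc n) = concatMap (λ w → map (λ s → s ∷ w) (U ∷ D ∷ R ∷ L ∷ [])) (words n)

p : ℕ → ℕ
p n = length (filter (λ w → isPSM w Data.Bool.≟ true) (words n))

Series : Set
Series = ℕ → ℚ

ℕtoℚ : ℕ → ℚ
ℕtoℚ n = + n / 1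

P : Series
P n = ℕtoℚ (p n)

sumℚ : List ℚ → ℚ
sumℚ = foldr _+q_ 0ℚ

_⋆_ : Series → Series → Series
(f ⋆ g) n = sumℚ (map (λ i → f i *q g (n ∸ i)) (upTo (suc n)))

_⊕_ : Series → Series → Series
(f ⊕ g) n = f n +q g n

_⊖_ : Series → Series → Series
(f ⊖ g) n = f n +q (-q (g n))

-- polynomial given by its coefficient list (constant term first)
poly : List ℤ → Series
poly [] n = 0ℚ
poly (c ∷ cs) zero = c / 1
poly (c ∷ cs) (suc n) = poly cs n

-- 1 - 4z + 2z^2 + z^4
radicand : Series
radicand = poly (+ 1 ∷ -[1+ 3 ] ∷ + 2 ∷ + 0 ∷ + 1 ∷ [])

-- numerator without the W part: 2 - 3z - 7z^2 - z^3 + z^4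
numPoly : Series
numPoly = poly (+ 2 ∷ -[1+ 2 ] ∷ -[1+ 6 ] ∷ -[1+ 0 ] ∷ + 1 ∷ [])

-- (2+z)(1+z) = 2 + 3z + z^2
wCoeff : Series
wCoeff = poly (+ 2 ∷ + 3 ∷ + 1 ∷ [])

-- 2z(1+z)(2z^2+3z-1) = -2z + 4z^2 + 10z^3 + 4z^4
denPoly : Series
denPoly = poly (+ 0 ∷ -[1+ 1 ] ∷ + 4 ∷ + 10 ∷ + 4 ∷ [])

-- Read a path step by step, keeping as state its current height and which of U, R its last step
-- forbids next.  The numbers of admissible continuations, as power series indexed by the states,
-- satisfy the first-step recurrence F = 1 + z·(sum of F over the allowed next states) at
-- non-negative heights, and such a recurrence determines its solution.  Multiplied by
-- d₀ = 1 − 3z − 2z², it is solved by a height-independent polynomial part plus A·μᵏ at height k: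
-- with V = ((1 − z)² − W)/(2z) and β = zV/(1 − z), the ratio μ = (1 + z)V + z is a root of the
-- characteristic equation μ(1 − z − β) = z(2 − β), and A = −(2 + z)V meets the boundary condition
-- at height 0.  Both reduce to zV² − (1 − z)²V + z(1 − z) = 0, which is W² = 1 − 4z + 2z² + z⁴ in
-- disguise.  At the initial state this gives d₀P = 1 + z − (2 + z)V, and multiplying by
-- −2z(1 + z) yields the formula.
module Submission where

open import Defs
open import Algebra.Bundles using (CommutativeRing)
import Algebra.Solver.Ring
open import Algebra.Solver.Ring.AlmostCommutativeRing using (fromCommutativeRing; _-Raw-AlmostCommutative⟶_)
open import Data.Bool as Bool using (Bool; true; false; _∧_; not; if_then_else_)
open import Data.Integer as ℤ using (ℤ; +_; -[1+_])
import Data.Integer.Properties as ℤ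
open import Data.List using (List; []; _∷_; _++_; map; applyUpTo; inits; length; filter; concatMap)
open import Data.List.Properties using (map-upTo; map-∘; map-cong)
open import Data.Maybe using (Maybe; just; nothing)
open import Data.Nat as ℕ using (ℕ; zero; suc; _∸_)
import Data.Nat.Coprimality as Coprime
import Data.Nat.Properties as ℕ
open import Data.Nat.Tactic.RingSolver using (solve-∀)
open import Data.Product using (_,_)
open import Data.Rational as ℚ using (ℚ; 0ℚ; 1ℚ)
import Data.Rational.Properties as ℚ
import Data.Rational.Solver as ℚ-Solver
open import Function using (_∘_)
open import Relation.Nullary using (yes; no)
import Relation.Binary.Reasoning.Setoid as SetoidReasoning
open import Relation.Binary.PropositionalEquality using (_≡_; refl; sym; trans; cong; cong₂; module ≡-Reasoning)

infix  4 _≈ₛ_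
infixl 30 _·_
infixr 35 _^_
infix  40 -ₛ_

-- Formal power series over ℚ

_≈ₛ_ : Series → Series → Set
f ≈ₛ g = ∀ n → f n ≡ g n

const : ℤ → Series
const c zero    = c ℚ./ 1
const c (suc _) = 0ℚ

0ₛ 1ₛ z : Series
0ₛ = const (+ 0)
1ₛ = const (+ 1)
z zero          = 0ℚ
z (suc zero)    = 1ℚ
z (suc (suc _)) = 0ℚ

0ₛ-coefficient : ∀ n → 0ₛ n ≡ 0ℚ
0ₛ-coefficient zero    = refl
0ₛ-coefficient (suc _) = refl

-ₛ_ : Series → Series
(-ₛ f) n = ℚ.- f n

shift : Series → Series
shift f n = f (suc n)

_·_ : Series → Series → Series
(f · g) zero    = f 0 ℚ.* g 0
(f · g) (suc n) = f 0 ℚ.* g (suc n) ℚ.+ (shift f · g) n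

_^_ : Series → ℕ → Series
f ^ zero  = 1ₛ
f ^ suc k = f · f ^ k

⋆≈· : ∀ f g → f ⋆ g ≈ₛ f · g
⋆≈· f g n = trans (cong sumℚ (map-upTo (λ i → f i ℚ.* g (n ∸ i)) (suc n))) (sum≡· f n)
  where
  sum≡· : ∀ f n → sumℚ (applyUpTo (λ i → f i ℚ.* g (n ∸ i)) (suc n)) ≡ (f · g) n
  sum≡· f zero    = ℚ.+-identityʳ _
  sum≡· f (suc n) = cong (f 0 ℚ.* g (suc n) ℚ.+_) (sum≡· (shift f) n)

·-cong : ∀ {f f′ g g′} → f ≈ₛ f′ → g ≈ₛ g′ → f · g ≈ₛ f′ · g′
·-cong f≈f′ g≈g′ zero    = cong₂ ℚ._*_ (f≈f′ 0) (g≈g′ 0)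
·-cong f≈f′ g≈g′ (suc n) =
  cong₂ ℚ._+_ (cong₂ ℚ._*_ (f≈f′ 0) (g≈g′ (suc n))) (·-cong (λ m → f≈f′ (suc m)) g≈g′ n)

·-congˡ : ∀ f {g h} → g ≈ₛ h → f · g ≈ₛ f · h
·-congˡ f = ·-cong (λ _ → refl)

⊕-congˡ : ∀ f {g h} → g ≈ₛ h → f ⊕ g ≈ₛ f ⊕ h
⊕-congˡ f g≈h n = cong (f n ℚ.+_) (g≈h n)

·-constˡ : ∀ c h n → (const c · h) n ≡ (c ℚ./ 1) ℚ.* h n
·-constˡ c h zero    = refl
·-constˡ c h (suc n) = trans (cong ((c ℚ./ 1) ℚ.* h (suc n) ℚ.+_) (shift-const·≈0 n)) (ℚ.+-identityʳ _)
  where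
  shift-const·≈0 : ∀ n → (shift (const c) · h) n ≡ 0ℚ
  shift-const·≈0 zero    = ℚ.*-zeroˡ (h 0)
  shift-const·≈0 (suc n) rewrite shift-const·≈0 n | ℚ.*-zeroˡ (h (suc n)) = refl

·-identityˡ : ∀ h → 1ₛ · h ≈ₛ h
·-identityˡ h n = trans (·-constˡ (+ 1) h n) (ℚ.*-identityˡ (h n))

·-distribʳ-⊕ : ∀ h f g → (f ⊕ g) · h ≈ₛ f · h ⊕ g · h
·-distribʳ-⊕ h f g zero    = ℚ.*-distribʳ-+ (h 0) (f 0) (g 0)
·-distribʳ-⊕ h f g (suc n) rewrite ·-distribʳ-⊕ h (shift f) (shift g) n =
  solve 5 (λ a b c x y → (a :+ b) :* c :+ (x :+ y) := (a :* c :+ x) :+ (b :* c :+ y)) refl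
    (f 0) (g 0) (h (suc n)) ((shift f · h) n) ((shift g · h) n)
  where open ℚ-Solver.+-*-Solver

·-sucʳ : ∀ f g n → (f · g) (suc n) ≡ f (suc n) ℚ.* g 0 ℚ.+ (f · shift g) n
·-sucʳ f g zero    = ℚ.+-comm (f 0 ℚ.* g 1) (f 1 ℚ.* g 0)
·-sucʳ f g (suc n) rewrite ·-sucʳ (shift f) g n =
  solve 3 (λ a b c → a :+ (b :+ c) := b :+ (a :+ c)) refl
    (f 0 ℚ.* g (suc (suc n))) (f (suc (suc n)) ℚ.* g 0) ((shift f · shift g) n)
  where open ℚ-Solver.+-*-Solver

·-comm : ∀ f g → f · g ≈ₛ g · f
·-comm f g zero    = ℚ.*-comm (f 0) (g 0)
·-comm f g (suc n) rewrite ·-sucʳ g f n | ·-comm (shift f) g n =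
  cong (ℚ._+ (g · shift f) n) (ℚ.*-comm (f 0) (g (suc n)))

·-scaleˡ : ∀ c f h → (λ n → c ℚ.* f n) · h ≈ₛ (λ n → c ℚ.* (f · h) n)
·-scaleˡ c f h zero    = ℚ.*-assoc c (f 0) (h 0)
·-scaleˡ c f h (suc n) rewrite ·-scaleˡ c (shift f) h n =
  solve 4 (λ c a b x → c :* a :* b :+ c :* x := c :* (a :* b :+ x)) refl c (f 0) (h (suc n)) ((shift f · h) n)
  where open ℚ-Solver.+-*-Solver

·-assoc : ∀ f g h → (f · g) · h ≈ₛ f · (g · h)
·-assoc f g h zero    = ℚ.*-assoc (f 0) (g 0) (h 0)
·-assoc f g h (suc n)
  rewrite ·-distribʳ-⊕ h (λ m → f 0 ℚ.* shift g m) (shift f · g) n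
        | ·-scaleˡ (f 0) (shift g) h n
        | ·-assoc (shift f) g h n =
  solve 5 (λ a b c x y → a :* b :* c :+ (a :* x :+ y) := a :* (b :* c :+ x) :+ y) refl
    (f 0) (g 0) (h (suc n)) ((shift g · h) n) ((shift f · (g · h)) n)
  where open ℚ-Solver.+-*-Solver

series-ring : CommutativeRing _ _
series-ring = record
  { Carrier = Series ; _≈_ = _≈ₛ_ ; _+_ = _⊕_ ; _*_ = _·_ ; -_ = -ₛ_ ; 0# = 0ₛ ; 1# = 1ₛ
  ; isCommutativeRing = record
    { isRing = record
      { +-isAbelianGroup = record
        { isGroup = record
          { isMonoid = record
            { isSemigroup = record
              { isMagma = record
                { isEquivalence = record
                  { refl = λ _ → refl ; sym = λ e n → sym (e n) ; trans = λ e e′ n → trans (e n) (e′ n) }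
                ; ∙-cong = λ e e′ n → cong₂ ℚ._+_ (e n) (e′ n) }
              ; assoc = λ f g h n → ℚ.+-assoc (f n) (g n) (h n) }
            ; identity = (λ f n → trans (cong (ℚ._+ f n) (0ₛ-coefficient n)) (ℚ.+-identityˡ (f n)))
                       , (λ f n → trans (cong (f n ℚ.+_) (0ₛ-coefficient n)) (ℚ.+-identityʳ (f n))) }
          ; inverse = (λ f n → trans (ℚ.+-inverseˡ (f n)) (sym (0ₛ-coefficient n)))
                    , (λ f n → trans (ℚ.+-inverseʳ (f n)) (sym (0ₛ-coefficient n)))
          ; ⁻¹-cong = λ e n → cong ℚ.-_ (e n) }
        ; comm = λ f g n → ℚ.+-comm (f n) (g n) }
      ; *-cong = ·-cong
      ; *-assoc = ·-assoc
      ; *-identity = ·-identityˡ , (λ h n → trans (·-comm h 1ₛ n) (·-identityˡ h n))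
      ; distrib = (λ h f g n → trans (·-comm h (f ⊕ g) n)
                                 (trans (·-distribʳ-⊕ h f g n) (cong₂ ℚ._+_ (·-comm f h n) (·-comm g h n))))
                , ·-distribʳ-⊕ }
    ; *-comm = ·-comm } }

open CommutativeRing series-ring using (setoid; +-cong; -‿cong; zeroʳ; *-identityʳ)
  renaming (refl to ≈-refl; sym to ≈-sym; trans to ≈-trans)

/1-canonical : ∀ c → c ℚ./ 1 ≡ ℚ.mkℚ c 0 (Coprime.sym (Coprime.1-coprimeTo ℤ.∣ c ∣))
/1-canonical (+ n)    = ℚ.normalize-coprime (Coprime.sym (Coprime.1-coprimeTo n))
/1-canonical -[1+ n ] = cong ℚ.-_ (ℚ.normalize-coprime (Coprime.sym (Coprime.1-coprimeTo (suc n))))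

/1-homo-+ : ∀ a b → (a ℤ.+ b) ℚ./ 1 ≡ (a ℚ./ 1) ℚ.+ (b ℚ./ 1)
/1-homo-+ a b rewrite /1-canonical a | /1-canonical b | ℤ.*-identityʳ a | ℤ.*-identityʳ b = refl

/1-homo-* : ∀ a b → (a ℤ.* b) ℚ./ 1 ≡ (a ℚ./ 1) ℚ.* (b ℚ./ 1)
/1-homo-* a b rewrite /1-canonical a | /1-canonical b = refl

/1-homo-neg : ∀ a → (ℤ.- a) ℚ./ 1 ≡ ℚ.- (a ℚ./ 1)
/1-homo-neg a rewrite /1-canonical a | /1-canonical (ℤ.- a) with a
... | + zero   = refl
... | + suc n  = refl
... | -[1+ n ] = refl

const-morphism : ℤ.+-*-rawRing -Raw-AlmostCommutative⟶ fromCommutativeRing series-ring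
const-morphism = record
  { ⟦_⟧    = const
  ; +-homo = λ { a b zero → /1-homo-+ a b ; a b (suc n) → sym (ℚ.+-identityˡ 0ℚ) }
  ; *-homo = λ a b n → trans (const-* a b n) (sym (·-constˡ a (const b) n))
  ; -‿homo = λ { a zero → /1-homo-neg a ; a (suc n) → refl }
  ; 0-homo = λ _ → refl
  ; 1-homo = λ _ → refl }
  where
  const-* : ∀ a b n → const (a ℤ.* b) n ≡ (a ℚ./ 1) ℚ.* const b n
  const-* a b zero    = /1-homo-* a b
  const-* a b (suc n) = sym (ℚ.*-zeroʳ (a ℚ./ 1))

const-equal? : ∀ a b → Maybe (const a ≈ₛ const b)
const-equal? a b with a ℤ.≟ b
... | yes refl = just (λ _ → refl)
... | no _     = nothing

open Algebra.Solver.Ring ℤ.+-*-rawRing (fromCommutativeRing series-ring) const-morphism const-equal?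
  using (Polynomial; solve; _:=_; con; _:+_; _:*_; :-_; _:-_)

z·-zero : ∀ f → (z · f) 0 ≡ 0ℚ
z·-zero f = ℚ.*-zeroˡ (f 0)

z·-suc : ∀ f n → (z · f) (suc n) ≡ f n
z·-suc f n = begin
  0ℚ ℚ.* f (suc n) ℚ.+ (shift z · f) n ≡⟨ cong (ℚ._+ (shift z · f) n) (ℚ.*-zeroˡ (f (suc n))) ⟩
  0ℚ ℚ.+ (shift z · f) n               ≡⟨ ℚ.+-identityˡ _ ⟩
  (shift z · f) n                      ≡⟨ ·-cong shift-z≈1 (λ _ → refl) n ⟩
  (1ₛ · f) n                           ≡⟨ ·-identityˡ f n ⟩
  f n                                  ∎
  where
  open ≡-Reasoning
  shift-z≈1 : shift z ≈ₛ 1ₛ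
  shift-z≈1 zero    = refl
  shift-z≈1 (suc _) = refl

z-cancel : ∀ {f} → z · f ≈ₛ 0ₛ → f ≈ₛ 0ₛ
z-cancel {f} zf≈0 n = trans (sym (z·-suc f n)) (trans (zf≈0 (suc n)) (sym (0ₛ-coefficient n)))

const-cancel : ∀ c .{{_ : ℚ.NonZero (c ℚ./ 1)}} {f} → const c · f ≈ₛ 0ₛ → f ≈ₛ 0ₛ
const-cancel c {f} cf≈0 n = begin
  f n                                     ≡⟨ sym (ℚ.*-identityˡ (f n)) ⟩
  1ℚ ℚ.* f n                              ≡⟨ cong (ℚ._* f n) (sym (ℚ.*-inverseˡ c′)) ⟩
  ℚ.1/ c′ ℚ.* c′ ℚ.* f n                  ≡⟨ ℚ.*-assoc (ℚ.1/ c′) c′ (f n) ⟩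
  ℚ.1/ c′ ℚ.* (c′ ℚ.* f n)                ≡⟨ cong (ℚ.1/ c′ ℚ.*_) (trans (sym (·-constˡ c f n)) (cf≈0 n)) ⟩
  ℚ.1/ c′ ℚ.* 0ₛ n                        ≡⟨ cong (ℚ.1/ c′ ℚ.*_) (0ₛ-coefficient n) ⟩
  ℚ.1/ c′ ℚ.* 0ℚ                          ≡⟨ ℚ.*-zeroʳ (ℚ.1/ c′) ⟩
  0ℚ                                      ≡⟨ sym (0ₛ-coefficient n) ⟩
  0ₛ n                                    ∎
  where
  open ≡-Reasoning
  c′ = c ℚ./ 1

≈-by-relation : ∀ {l r} c {a b} → l ≈ₛ r ⊕ c · (a ⊖ b) → a ≈ₛ b → l ≈ₛ r
≈-by-relation {l} {r} c {a} {b} l≈ a≈b = begin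
  l                  ≈⟨ l≈ ⟩
  r ⊕ c · (a ⊖ b)    ≈⟨ ⊕-congˡ r (·-congˡ c (λ n → cong (ℚ._+ ℚ.- b n) (a≈b n))) ⟩
  r ⊕ c · (b ⊖ b)    ≈⟨ solve 3 (λ r c b → r :+ c :* (b :- b) := r) ≈-refl r c b ⟩
  r                  ∎
  where open SetoidReasoning setoid

≈-by-relations : ∀ {l r} c₁ {a₁ b₁} c₂ {a₂ b₂} → l ≈ₛ r ⊕ (c₁ · (a₁ ⊖ b₁) ⊕ c₂ · (a₂ ⊖ b₂)) →
                 a₁ ≈ₛ b₁ → a₂ ≈ₛ b₂ → l ≈ₛ r
≈-by-relations {l} {r} c₁ {a₁} {b₁} c₂ {a₂} {b₂} l≈ a₁≈b₁ a₂≈b₂ =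
  ≈-by-relation c₂ (≈-by-relation c₁ (≈-trans l≈ (solve 7
    (λ r c₁ a₁ b₁ c₂ a₂ b₂ → r :+ (c₁ :* (a₁ :- b₁) :+ c₂ :* (a₂ :- b₂))
                           := (r :+ c₂ :* (a₂ :- b₂)) :+ c₁ :* (a₁ :- b₁))
    ≈-refl r c₁ a₁ b₁ c₂ a₂ b₂)) a₁≈b₁) a₂≈b₂

horner : List ℤ → Series
horner []       = 0ₛ
horner (c ∷ cs) = const c ⊕ z · horner cs

hornerₚ : ∀ {m} → List ℤ → Polynomial m → Polynomial m
hornerₚ []       x = con (+ 0)
hornerₚ (c ∷ cs) x = con c :+ x :* hornerₚ cs x

poly≈horner : ∀ cs → poly cs ≈ₛ horner cs
poly≈horner []       n       = sym (0ₛ-coefficient n)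
poly≈horner (c ∷ cs) zero    = sym (trans (cong (c ℚ./ 1 ℚ.+_) (z·-zero (horner cs))) (ℚ.+-identityʳ _))
poly≈horner (c ∷ cs) (suc n) =
  trans (poly≈horner cs n) (sym (trans (ℚ.+-identityˡ _) (z·-suc (horner cs) n)))

ones : Series
ones _ = 1ℚ

ones-inverse : (1ₛ ⊖ z) · ones ≈ₛ 1ₛ
ones-inverse = ≈-trans (solve 2 (λ z g → (con (+ 1) :- z) :* g := g :- z :* g) ≈-refl z ones) telescope
  where
  telescope : ones ⊖ z · ones ≈ₛ 1ₛ
  telescope zero    = cong (λ x → 1ℚ ℚ.+ ℚ.- x) (z·-zero ones)
  telescope (suc n) = trans (cong (λ x → 1ℚ ℚ.+ ℚ.- x) (z·-suc ones n)) (ℚ.+-inverseʳ 1ℚ)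

-- Paths read from a state

data Last : Set where
  neutral up red : Last

last : Step → Last
last U = up
last R = red
last D = neutral
last L = neutral

allowed : Last → Step → Bool
allowed neutral s = true
allowed up      s = not (badPair U s)
allowed red     s = not (badPair R s)

startsAllowed : Last → List Step → Bool
startsAllowed a []      = true
startsAllowed a (s ∷ _) = allowed a s

nonNegFrom : ℤ → List Step → Bool
nonNegFrom o w = allB (map (λ pre → + 0 ℤ.≤ᵇ o ℤ.+ height pre) (inits w))

-- w is a valid continuation of a path at height o whose last step is of kind a.
admissibleFrom : ℤ → Last → List Step → Bool
admissibleFrom o a w = nonNegFrom o w ∧ (startsAllowed a w ∧ noBadPair w)

nonNegFrom-∷ : ∀ o s w → nonNegFrom o (s ∷ w) ≡ (+ 0 ℤ.≤ᵇ o) ∧ nonNegFrom (disp s ℤ.+ o) w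
nonNegFrom-∷ o s w = cong₂ _∧_ (cong (+ 0 ℤ.≤ᵇ_) (ℤ.+-identityʳ o))
  (trans (cong allB (sym (map-∘ (inits w))))
         (cong allB (map-cong (λ pre → cong (+ 0 ℤ.≤ᵇ_) (rebase pre)) (inits w))))
  where
  rebase : ∀ pre → o ℤ.+ (disp s ℤ.+ height pre) ≡ (disp s ℤ.+ o) ℤ.+ height pre
  rebase pre = trans (sym (ℤ.+-assoc o (disp s) (height pre))) (cong (ℤ._+ height pre) (ℤ.+-comm o (disp s)))

noBadPair-∷ : ∀ s w → noBadPair (s ∷ w) ≡ startsAllowed (last s) w ∧ noBadPair w
noBadPair-∷ s []      = refl
noBadPair-∷ s (t ∷ w) = cong (_∧ noBadPair (t ∷ w)) (not-badPair s)
  where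
  not-badPair : ∀ s → not (badPair s t) ≡ allowed (last s) t
  not-badPair U = refl
  not-badPair R = refl
  not-badPair D = refl
  not-badPair L = refl

admissibleFrom-∷ : ∀ o a s w → admissibleFrom o a (s ∷ w)
                   ≡ (+ 0 ℤ.≤ᵇ o) ∧ (allowed a s ∧ admissibleFrom (disp s ℤ.+ o) (last s) w)
admissibleFrom-∷ o a s w rewrite nonNegFrom-∷ o s w | noBadPair-∷ s w =
  ∧-interchange (+ 0 ℤ.≤ᵇ o) (nonNegFrom (disp s ℤ.+ o) w) (allowed a s) _
  where
  ∧-interchange : ∀ a b c d → (a ∧ b) ∧ (c ∧ d) ≡ a ∧ (c ∧ (b ∧ d))
  ∧-interchange false b     c     d = refl
  ∧-interchange true  false false d = refl
  ∧-interchange true  false true  d = refl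
  ∧-interchange true  true  c     d = refl

isPSM≡admissibleFrom0 : ∀ w → isPSM w ≡ admissibleFrom (+ 0) neutral w
isPSM≡admissibleFrom0 w = cong₂ _∧_
  (cong allB (map-cong (λ pre → cong (+ 0 ℤ.≤ᵇ_) (sym (ℤ.+-identityˡ (height pre)))) (inits w)))
  (startsAllowed-neutral w)
  where
  startsAllowed-neutral : ∀ w → noBadPair w ≡ startsAllowed neutral w ∧ noBadPair w
  startsAllowed-neutral []      = refl
  startsAllowed-neutral (_ ∷ _) = refl

indicator : Bool → ℕ
indicator b = if b then 1 else 0

count : (List Step → Bool) → List (List Step) → ℕ
count b ws = length (filter (λ w → b w Bool.≟ true) ws)

count-∷ : ∀ b w ws → count b (w ∷ ws) ≡ indicator (b w) ℕ.+ count b ws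
count-∷ b w ws with b w
... | true  = refl
... | false = refl

count-++ : ∀ b ws vs → count b (ws ++ vs) ≡ count b ws ℕ.+ count b vs
count-++ b []       vs = refl
count-++ b (w ∷ ws) vs = begin
  count b (w ∷ ws ++ vs)                          ≡⟨ count-∷ b w (ws ++ vs) ⟩
  indicator (b w) ℕ.+ count b (ws ++ vs)          ≡⟨ cong (indicator (b w) ℕ.+_) (count-++ b ws vs) ⟩
  indicator (b w) ℕ.+ (count b ws ℕ.+ count b vs) ≡⟨ sym (ℕ.+-assoc (indicator (b w)) _ _) ⟩
  (indicator (b w) ℕ.+ count b ws) ℕ.+ count b vs ≡⟨ cong (ℕ._+ count b vs) (sym (count-∷ b w ws)) ⟩
  count b (w ∷ ws) ℕ.+ count b vs                 ∎
  where open ≡-Reasoning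

count-cong : ∀ {b b′} → (∀ w → b w ≡ b′ w) → ∀ ws → count b ws ≡ count b′ ws
count-cong         b≡b′ []       = refl
count-cong {b} {b′} b≡b′ (w ∷ ws) = begin
  count b (w ∷ ws)                 ≡⟨ count-∷ b w ws ⟩
  indicator (b w) ℕ.+ count b ws   ≡⟨ cong₂ ℕ._+_ (cong indicator (b≡b′ w)) (count-cong b≡b′ ws) ⟩
  indicator (b′ w) ℕ.+ count b′ ws ≡⟨ sym (count-∷ b′ w ws) ⟩
  count b′ (w ∷ ws)                ∎
  where open ≡-Reasoning

count-∧ : ∀ c b ws → count (λ w → c ∧ b w) ws ≡ (if c then count b ws else 0)
count-∧ true  b ws       = refl
count-∧ false b []       = refl
count-∧ false b (w ∷ ws) = count-∧ false b ws

count-words-suc : ∀ b n → count b (words (suc n)) ≡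
  ((count (b ∘ (U ∷_)) (words n) ℕ.+ count (b ∘ (D ∷_)) (words n))
    ℕ.+ count (b ∘ (R ∷_)) (words n)) ℕ.+ count (b ∘ (L ∷_)) (words n)
count-words-suc b n = by-first-step (words n)
  where
  extensions : List Step → List (List Step)
  extensions w = (U ∷ w) ∷ (D ∷ w) ∷ (R ∷ w) ∷ (L ∷ w) ∷ []
  by-first-step : ∀ ws → count b (concatMap extensions ws) ≡
    ((count (b ∘ (U ∷_)) ws ℕ.+ count (b ∘ (D ∷_)) ws) ℕ.+ count (b ∘ (R ∷_)) ws) ℕ.+ count (b ∘ (L ∷_)) ws
  by-first-step []       = refl
  by-first-step (w ∷ ws) = begin
    count b (extensions w ++ concatMap extensions ws)
      ≡⟨ count-++ b (extensions w) (concatMap extensions ws) ⟩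
    count b (extensions w) ℕ.+ count b (concatMap extensions ws)
      ≡⟨ cong₂ ℕ._+_ (trans (count-∷ b _ _) (cong (χ U ℕ.+_) (trans (count-∷ b _ _) (cong (χ D ℕ.+_)
           (trans (count-∷ b _ _) (cong (χ R ℕ.+_) (count-∷ b _ _))))))) (by-first-step ws) ⟩
    (χ U ℕ.+ (χ D ℕ.+ (χ R ℕ.+ (χ L ℕ.+ 0)))) ℕ.+ (((tally ws U ℕ.+ tally ws D) ℕ.+ tally ws R) ℕ.+ tally ws L)
      ≡⟨ interleave (χ U) (χ D) (χ R) (χ L) (tally ws U) (tally ws D) (tally ws R) (tally ws L) ⟩
    ((χ U ℕ.+ tally ws U ℕ.+ (χ D ℕ.+ tally ws D)) ℕ.+ (χ R ℕ.+ tally ws R)) ℕ.+ (χ L ℕ.+ tally ws L)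
      ≡⟨ sym (cong₂ ℕ._+_ (cong₂ ℕ._+_ (cong₂ ℕ._+_ (tally-∷ U) (tally-∷ D)) (tally-∷ R)) (tally-∷ L)) ⟩
    ((tally (w ∷ ws) U ℕ.+ tally (w ∷ ws) D) ℕ.+ tally (w ∷ ws) R) ℕ.+ tally (w ∷ ws) L ∎
    where
    open ≡-Reasoning
    χ : Step → ℕ
    χ s = indicator (b (s ∷ w))
    tally : List (List Step) → Step → ℕ
    tally vs s = count (b ∘ (s ∷_)) vs
    tally-∷ : ∀ s → tally (w ∷ ws) s ≡ χ s ℕ.+ tally ws s
    tally-∷ s = count-∷ (b ∘ (s ∷_)) w ws
    interleave : ∀ a b c d A B C D →
      (a ℕ.+ (b ℕ.+ (c ℕ.+ (d ℕ.+ 0)))) ℕ.+ (((A ℕ.+ B) ℕ.+ C) ℕ.+ D)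
      ≡ ((a ℕ.+ A ℕ.+ (b ℕ.+ B)) ℕ.+ (c ℕ.+ C)) ℕ.+ (d ℕ.+ D)
    interleave = solve-∀

pathCount : ℕ → ℤ → Last → ℕ
pathCount n o a = count (admissibleFrom o a) (words n)

continuations : ℕ → ℤ → Last → Step → ℕ
continuations n o a s = if allowed a s then pathCount n (disp s ℤ.+ o) (last s) else 0

pathCount-zero : ∀ o a → pathCount 0 o a ≡ indicator (+ 0 ℤ.≤ᵇ o)
pathCount-zero o a rewrite ℤ.+-identityʳ o with + 0 ℤ.≤ᵇ o
... | true  = refl
... | false = refl

pathCount-suc : ∀ n o a → pathCount (suc n) o a ≡
  (if + 0 ℤ.≤ᵇ o then ((continuations n o a U ℕ.+ continuations n o a D) ℕ.+ continuations n o a R)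
                      ℕ.+ continuations n o a L else 0)
pathCount-suc n o a = trans (count-words-suc (admissibleFrom o a) n)
  (trans (cong₂ ℕ._+_ (cong₂ ℕ._+_ (cong₂ ℕ._+_ (first U) (first D)) (first R)) (first L))
         (if-distrib (+ 0 ℤ.≤ᵇ o)))
  where
  first : ∀ s → count (admissibleFrom o a ∘ (s ∷_)) (words n)
                ≡ (if + 0 ℤ.≤ᵇ o then continuations n o a s else 0)
  first s = begin
    count (admissibleFrom o a ∘ (s ∷_)) (words n)
      ≡⟨ count-cong (admissibleFrom-∷ o a s) (words n) ⟩
    count (λ w → (+ 0 ℤ.≤ᵇ o) ∧ (allowed a s ∧ admissibleFrom (disp s ℤ.+ o) (last s) w)) (words n)
      ≡⟨ count-∧ (+ 0 ℤ.≤ᵇ o) _ (words n) ⟩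
    (if + 0 ℤ.≤ᵇ o then count (λ w → allowed a s ∧ admissibleFrom (disp s ℤ.+ o) (last s) w) (words n) else 0)
      ≡⟨ cong (λ m → if + 0 ℤ.≤ᵇ o then m else 0) (count-∧ (allowed a s) _ (words n)) ⟩
    (if + 0 ℤ.≤ᵇ o then continuations n o a s else 0) ∎
    where open ≡-Reasoning
  if-distrib : ∀ c {x y u v} → ((if c then x else 0) ℕ.+ (if c then y else 0) ℕ.+ (if c then u else 0))
    ℕ.+ (if c then v else 0) ≡ (if c then ((x ℕ.+ y) ℕ.+ u) ℕ.+ v else 0)
  if-distrib true  = refl
  if-distrib false = refl

-- The first-step recurrence

guard : Bool → Series → Series
guard true  f = f
guard false f = 0ₛ

guard-at : ∀ b {f g} n → f n ≡ g n → guard b f n ≡ guard b g n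
guard-at true  n fn≡gn = fn≡gn
guard-at false n fn≡gn = refl

guard-cong : ∀ b {f g} → f ≈ₛ g → guard b f ≈ₛ guard b g
guard-cong b f≈g n = guard-at b n (f≈g n)

guard-scale : ∀ b f g → f · guard b g ≈ₛ guard b (f · g)
guard-scale true  f g = ≈-refl
guard-scale false f g = zeroʳ f

Family : Set
Family = ℤ → Last → Series

transfer : Family → ℤ → Last → Series
transfer F o a = ((move U ⊕ move D) ⊕ move R) ⊕ move L
  where
  move : Step → Series
  move s = guard (allowed a s) (F (disp s ℤ.+ o) (last s))

Solution : Series → Family → Set
Solution c F = ∀ o a → F o a ≈ₛ guard (+ 0 ℤ.≤ᵇ o) (c ⊕ z · transfer F o a)

transfer-at : ∀ {F G} n → (∀ o a → F o a n ≡ G o a n) → ∀ o a → transfer F o a n ≡ transfer G o a n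
transfer-at {F} {G} n F≡G o a = cong₂ ℚ._+_ (cong₂ ℚ._+_ (cong₂ ℚ._+_ (move U) (move D)) (move R)) (move L)
  where
  move : ∀ s → guard (allowed a s) (F (disp s ℤ.+ o) (last s)) n
             ≡ guard (allowed a s) (G (disp s ℤ.+ o) (last s)) n
  move s = guard-at (allowed a s) n (F≡G (disp s ℤ.+ o) (last s))

solution-unique : ∀ {c c′ F G} → c ≈ₛ c′ → Solution c F → Solution c′ G → ∀ o a → F o a ≈ₛ G o a
solution-unique {c} {c′} {F} {G} c≈c′ F-sol G-sol o a n = agree n o a
  where
  agree : ∀ n o a → F o a n ≡ G o a n
  unfolded : ∀ n o a → (c ⊕ z · transfer F o a) n ≡ (c′ ⊕ z · transfer G o a) n
  agree n o a = trans (F-sol o a n) (trans (guard-at (+ 0 ℤ.≤ᵇ o) n (unfolded n o a)) (sym (G-sol o a n)))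
  unfolded zero    o a = cong₂ ℚ._+_ (c≈c′ 0) (trans (z·-zero (transfer F o a)) (sym (z·-zero (transfer G o a))))
  unfolded (suc n) o a = cong₂ ℚ._+_ (c≈c′ (suc n)) (begin
    (z · transfer F o a) (suc n) ≡⟨ z·-suc (transfer F o a) n ⟩
    transfer F o a n             ≡⟨ transfer-at {F} {G} n (agree n) o a ⟩
    transfer G o a n             ≡⟨ sym (z·-suc (transfer G o a) n) ⟩
    (z · transfer G o a) (suc n) ∎)
    where open ≡-Reasoning

transfer-scale : ∀ f F o a → f · transfer F o a ≈ₛ transfer (λ o a → f · F o a) o a
transfer-scale f F o a = ≈-trans
  (solve 5 (λ f u d r l → f :* (((u :+ d) :+ r) :+ l) := ((f :* u :+ f :* d) :+ f :* r) :+ f :* l) ≈-refl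
    f (move U) (move D) (move R) (move L))
  (+-cong (+-cong (+-cong (moved U) (moved D)) (moved R)) (moved L))
  where
  move : Step → Series
  move s = guard (allowed a s) (F (disp s ℤ.+ o) (last s))
  moved : ∀ s → f · move s ≈ₛ guard (allowed a s) (f · F (disp s ℤ.+ o) (last s))
  moved s = guard-scale (allowed a s) f (F (disp s ℤ.+ o) (last s))

solution-scale : ∀ f {c F} → Solution c F → Solution (f · c) (λ o a → f · F o a)
solution-scale f {c} {F} F-sol o a = begin
  f · F o a                                              ≈⟨ ·-congˡ f (F-sol o a) ⟩
  f · guard b (c ⊕ z · transfer F o a)                   ≈⟨ guard-scale b f _ ⟩
  guard b (f · (c ⊕ z · transfer F o a))                 ≈⟨ guard-cong b distribute ⟩
  guard b (f · c ⊕ z · transfer (λ o a → f · F o a) o a) ∎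
  where
  open SetoidReasoning setoid
  b = + 0 ℤ.≤ᵇ o
  distribute : f · (c ⊕ z · transfer F o a) ≈ₛ f · c ⊕ z · transfer (λ o a → f · F o a) o a
  distribute = begin
    f · (c ⊕ z · transfer F o a)
      ≈⟨ solve 4 (λ f c z t → f :* (c :+ z :* t) := f :* c :+ z :* (f :* t)) ≈-refl f c z (transfer F o a) ⟩
    f · c ⊕ z · (f · transfer F o a)
      ≈⟨ ⊕-congˡ (f · c) (·-congˡ z (transfer-scale f F o a)) ⟩
    f · c ⊕ z · transfer (λ o a → f · F o a) o a ∎

paths : Family
paths o a n = ℕtoℚ (pathCount n o a)

paths-solution : Solution 1ₛ paths
paths-solution o a zero    = trans (cong ℕtoℚ (pathCount-zero o a)) (constant-term (+ 0 ℤ.≤ᵇ o))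
  where
  constant-term : ∀ b → ℕtoℚ (indicator b) ≡ guard b (1ₛ ⊕ z · transfer paths o a) 0
  constant-term true  = sym (trans (cong (1ℚ ℚ.+_) (z·-zero (transfer paths o a))) (ℚ.+-identityʳ 1ℚ))
  constant-term false = refl
paths-solution o a (suc n) = trans (cong ℕtoℚ (pathCount-suc n o a)) (coefficient (+ 0 ℤ.≤ᵇ o))
  where
  k : Step → ℕ
  k = continuations n o a
  ℕtoℚ-+ : ∀ m l → ℕtoℚ (m ℕ.+ l) ≡ ℕtoℚ m ℚ.+ ℕtoℚ l
  ℕtoℚ-+ m l = /1-homo-+ (+ m) (+ l)
  moved : ∀ s → ℕtoℚ (k s) ≡ guard (allowed a s) (paths (disp s ℤ.+ o) (last s)) n
  moved s with allowed a s
  ... | true  = refl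
  ... | false = sym (0ₛ-coefficient n)
  coefficient : ∀ b → ℕtoℚ (if b then ((k U ℕ.+ k D) ℕ.+ k R) ℕ.+ k L else 0)
                      ≡ guard b (1ₛ ⊕ z · transfer paths o a) (suc n)
  coefficient false = refl
  coefficient true  = begin
    ℕtoℚ (((k U ℕ.+ k D) ℕ.+ k R) ℕ.+ k L)
      ≡⟨ trans (ℕtoℚ-+ (k U ℕ.+ k D ℕ.+ k R) (k L)) (cong₂ ℚ._+_ (trans (ℕtoℚ-+ (k U ℕ.+ k D) (k R))
           (cong₂ ℚ._+_ (trans (ℕtoℚ-+ (k U) (k D)) (cong₂ ℚ._+_ (moved U) (moved D))) (moved R))) (moved L)) ⟩
    transfer paths o a n
      ≡⟨ sym (trans (ℚ.+-identityˡ _) (z·-suc (transfer paths o a) n)) ⟩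
    (1ₛ ⊕ z · transfer paths o a) (suc n) ∎
    where open ≡-Reasoning

P≈paths : P ≈ₛ paths (+ 0) neutral
P≈paths n = cong ℕtoℚ (count-cong isPSM≡admissibleFrom0 (words n))

-- An explicit solution

d₀ : Series
d₀ = (1ₛ ⊖ const (+ 3) · z) ⊖ const (+ 2) · z · z

module CandidateSyntax {m : ℕ} (z A μ β : Polynomial m) where

  d₀ₚ : Polynomial m
  d₀ₚ = con (+ 1) :- con (+ 3) :* z :- con (+ 2) :* z :* z

  neutralₚ redₚ upₚ : Polynomial m → Polynomial m
  neutralₚ p = (con (+ 1) :+ z) :+ A :* p
  redₚ     p = con (+ 1) :+ A :* (con (+ 1) :- β) :* p
  upₚ      p = con (+ 1) :+ A :* (μ :- z :* (con (+ 1) :- β)) :* p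

  ratio-gapₚ characteristic-gapₚ boundary-gapₚ : Polynomial m
  ratio-gapₚ          = z :* (μ :- z :* (con (+ 1) :- β)) :- β
  characteristic-gapₚ = μ :* ((con (+ 1) :- z) :- β) :- z :* (con (+ 2) :- β)
  boundary-gapₚ       = A :* ((con (+ 1) :- z) :- β) :- :- (z :* (con (+ 2) :+ z))

module GeometricCandidate
  (A μ β : Series)
  (ratio          : z · (μ ⊖ z · (1ₛ ⊖ β)) ≈ₛ β)
  (characteristic : μ · ((1ₛ ⊖ z) ⊖ β) ≈ₛ z · (const (+ 2) ⊖ β))
  (boundary       : A · ((1ₛ ⊖ z) ⊖ β) ≈ₛ -ₛ (z · (const (+ 2) ⊕ z)))
  where

  candidate : Family
  candidate -[1+ _ ]  _       = 0ₛ
  candidate (+ k)     neutral = (1ₛ ⊕ z) ⊕ A · μ ^ k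
  candidate (+ k)     red     = 1ₛ ⊕ A · (1ₛ ⊖ β) · μ ^ k
  -- The state (0, up) is unreachable; this value makes the recurrence hold there as well.
  candidate (+ zero)  up      = candidate (+ zero) neutral
  candidate (+ suc k) up      = 1ₛ ⊕ A · (μ ⊖ z · (1ₛ ⊖ β)) · μ ^ k

  candidate-solution : Solution d₀ candidate
  candidate-solution -[1+ _ ]  _       = ≈-refl
  candidate-solution (+ zero)  neutral = ≈-by-relations (-ₛ A) 1ₛ (solve 4 (λ z A μ β →
    let open CandidateSyntax z A μ β in
    neutralₚ (con (+ 1))
      := d₀ₚ :+ z :* (((upₚ (con (+ 1)) :+ con (+ 0)) :+ con (+ 0)) :+ neutralₚ (con (+ 1)))
         :+ ((:- A) :* ratio-gapₚ :+ con (+ 1) :* boundary-gapₚ))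
    ≈-refl z A μ β) ratio boundary
  candidate-solution (+ zero)  up      = candidate-solution (+ zero) neutral
  candidate-solution (+ zero)  red     = ≈-by-relation 1ₛ (solve 4 (λ z A μ β →
    let open CandidateSyntax z A μ β in
    redₚ (con (+ 1))
      := d₀ₚ :+ z :* (((con (+ 0) :+ con (+ 0)) :+ con (+ 0)) :+ neutralₚ (con (+ 1)))
         :+ con (+ 1) :* boundary-gapₚ)
    ≈-refl z A μ β) boundary
  candidate-solution (+ suc j) neutral = ≈-by-relations (-ₛ (A · μ ^ j · μ)) (A · μ ^ j) (solve 5 (λ z A μ β p →
    let open CandidateSyntax z A μ β in
    neutralₚ (μ :* p)
      := d₀ₚ :+ z :* (((upₚ (μ :* p) :+ neutralₚ p) :+ redₚ p) :+ neutralₚ (μ :* p))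
         :+ ((:- (A :* p :* μ)) :* ratio-gapₚ :+ A :* p :* characteristic-gapₚ))
    ≈-refl z A μ β (μ ^ j)) ratio characteristic
  candidate-solution (+ suc j) up      = ≈-by-relations (-ₛ (A · μ ^ j · μ)) (A · μ ^ j) (solve 5 (λ z A μ β p →
    let open CandidateSyntax z A μ β in
    upₚ p
      := d₀ₚ :+ z :* (((upₚ (μ :* p) :+ neutralₚ p) :+ con (+ 0)) :+ neutralₚ (μ :* p))
         :+ ((:- (A :* p :* μ)) :* ratio-gapₚ :+ A :* p :* characteristic-gapₚ))
    ≈-refl z A μ β (μ ^ j)) ratio characteristic
  candidate-solution (+ suc j) red     = ≈-by-relation (A · μ ^ j) (solve 5 (λ z A μ β p →
    let open CandidateSyntax z A μ β in
    redₚ (μ :* p)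
      := d₀ₚ :+ z :* (((con (+ 0) :+ neutralₚ p) :+ redₚ p) :+ neutralₚ (μ :* p))
         :+ A :* p :* characteristic-gapₚ)
    ≈-refl z A μ β (μ ^ j)) characteristic

module SquareRoot (W : Series) (W₀ : W 0 ≡ 1ℚ) (W² : ∀ n → (W ⋆ W) n ≡ radicand n) where

  Δ : Series
  Δ = (1ₛ ⊖ z) · (1ₛ ⊖ z) ⊖ W

  -- V = Δ / (2z), which is a power series because Δ 0 = 1 − W 0 = 0.
  V : Series
  V n = ℚ.½ ℚ.* Δ (suc n)

  two-zV≈Δ : const (+ 2) · (z · V) ≈ₛ Δ
  two-zV≈Δ n = trans (·-constˡ (+ 2) (z · V) n) (coefficient n)
    where
    coefficient : ∀ n → (+ 2 ℚ./ 1) ℚ.* (z · V) n ≡ Δ n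
    coefficient zero    rewrite z·-zero V | W₀ = refl
    coefficient (suc n) rewrite z·-suc V n =
      trans (sym (ℚ.*-assoc (+ 2 ℚ./ 1) ℚ.½ (Δ (suc n)))) (ℚ.*-identityˡ (Δ (suc n)))

  radicand-coefficients : List ℤ
  radicand-coefficients = + 1 ∷ -[1+ 3 ] ∷ + 2 ∷ + 0 ∷ + 1 ∷ []

  W·W≈radicand : W · W ≈ₛ horner radicand-coefficients
  W·W≈radicand n = trans (sym (⋆≈· W W n)) (trans (W² n) (poly≈horner radicand-coefficients n))

  V-quadratic : z · V · V ⊕ z · (1ₛ ⊖ z) ≈ₛ (1ₛ ⊖ z) · (1ₛ ⊖ z) · V
  V-quadratic = ≈-by-relation 1ₛ
    (solve 2 (λ x y → x := y :+ con (+ 1) :* ((x :- y) :- con (+ 0))) ≈-refl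
      (z · V · V ⊕ z · (1ₛ ⊖ z)) ((1ₛ ⊖ z) · (1ₛ ⊖ z) · V))
    (z-cancel (const-cancel (+ 4) four-z-gap≈0))
    where
    four-z-gap≈0 : const (+ 4) · (z · ((z · V · V ⊕ z · (1ₛ ⊖ z)) ⊖ (1ₛ ⊖ z) · (1ₛ ⊖ z) · V)) ≈ₛ 0ₛ
    four-z-gap≈0 = ≈-by-relations ((const (+ 2) · (z · V) ⊖ (1ₛ ⊖ z) · (1ₛ ⊖ z)) ⊖ W) 1ₛ
      (solve 3 (λ z V W →
        let 1-z = con (+ 1) :- z in
        con (+ 4) :* (z :* ((z :* V :* V :+ z :* 1-z) :- 1-z :* 1-z :* V))
          := con (+ 0) :+ ((con (+ 2) :* (z :* V) :- 1-z :* 1-z :- W) :* (con (+ 2) :* (z :* V) :- (1-z :* 1-z :- W))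
                            :+ con (+ 1) :* (W :* W :- hornerₚ radicand-coefficients z)))
        ≈-refl z V W)
      two-zV≈Δ W·W≈radicand

  β μ A : Series
  β = z · V · ones
  μ = (1ₛ ⊕ z) · V ⊕ z
  A = -ₛ ((const (+ 2) ⊕ z) · V)

  β-ratio : β · (1ₛ ⊖ z) ≈ₛ z · V
  β-ratio = ≈-by-relation (z · V) (solve 3 (λ z V g →
    z :* V :* g :* (con (+ 1) :- z) := z :* V :+ z :* V :* ((con (+ 1) :- z) :* g :- con (+ 1)))
    ≈-refl z V ones) ones-inverse

  V-boundary : V · ((1ₛ ⊖ z) ⊖ β) ≈ₛ z
  V-boundary = ≈-by-relations (-ₛ ones) (z ⊖ V · (1ₛ ⊖ z)) (solve 3 (λ z V g →
    let 1-z = con (+ 1) :- z in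
    V :* (1-z :- z :* V :* g)
      := z :+ ((:- g) :* ((z :* V :* V :+ z :* 1-z) :- 1-z :* 1-z :* V)
               :+ (z :- V :* 1-z) :* (1-z :* g :- con (+ 1))))
    ≈-refl z V ones) V-quadratic ones-inverse

  ratio : z · (μ ⊖ z · (1ₛ ⊖ β)) ≈ₛ β
  ratio = ≈-by-relation (-ₛ (1ₛ ⊕ z)) (solve 3 (λ z V β →
    z :* (((con (+ 1) :+ z) :* V :+ z) :- z :* (con (+ 1) :- β))
      := β :+ (:- (con (+ 1) :+ z)) :* (β :* (con (+ 1) :- z) :- z :* V))
    ≈-refl z V β) β-ratio

  characteristic : μ · ((1ₛ ⊖ z) ⊖ β) ≈ₛ z · (const (+ 2) ⊖ β)
  characteristic = ≈-by-relation (1ₛ ⊕ z) (solve 3 (λ z V β →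
    ((con (+ 1) :+ z) :* V :+ z) :* ((con (+ 1) :- z) :- β)
      := z :* (con (+ 2) :- β) :+ (con (+ 1) :+ z) :* (V :* ((con (+ 1) :- z) :- β) :- z))
    ≈-refl z V β) V-boundary

  boundary : A · ((1ₛ ⊖ z) ⊖ β) ≈ₛ -ₛ (z · (const (+ 2) ⊕ z))
  boundary = ≈-by-relation (-ₛ (const (+ 2) ⊕ z)) (solve 3 (λ z V β →
    (:- ((con (+ 2) :+ z) :* V)) :* ((con (+ 1) :- z) :- β)
      := :- (z :* (con (+ 2) :+ z)) :+ (:- (con (+ 2) :+ z)) :* (V :* ((con (+ 1) :- z) :- β) :- z))
    ≈-refl z V β) V-boundary

  open GeometricCandidate A μ β ratio characteristic boundary public

  -- denPoly = −2z(1 + z)·d₀ and wCoeff = (1 + z)(2 + z) are the cofactors of the two relations.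
  elimination : ∀ {X} → d₀ · X ≈ₛ candidate (+ 0) neutral → denPoly · X ≈ₛ numPoly ⊖ wCoeff · W
  elimination {X} d₀X≈ = begin
    denPoly · X                 ≈⟨ ·-cong (poly≈horner den) ≈-refl ⟩
    horner den · X
      ≈⟨ ≈-by-relations (-ₛ (const (+ 2) · z · (1ₛ ⊕ z))) ((1ₛ ⊕ z) · (const (+ 2) ⊕ z))
           (solve 4 (λ z X V W →
             let 1-z = con (+ 1) :- z in
             hornerₚ den z :* X
               := (hornerₚ num z :- hornerₚ wc z :* W)
                  :+ ((:- (con (+ 2) :* z :* (con (+ 1) :+ z)))
                        :* ((con (+ 1) :- con (+ 3) :* z :- con (+ 2) :* z :* z) :* X
                            :- ((con (+ 1) :+ z) :+ (:- ((con (+ 2) :+ z) :* V)) :* con (+ 1)))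
                      :+ (con (+ 1) :+ z) :* (con (+ 2) :+ z) :* (con (+ 2) :* (z :* V) :- (1-z :* 1-z :- W))))
             ≈-refl z X V W)
           d₀X≈ two-zV≈Δ ⟩
    horner num ⊖ horner wc · W
      ≈⟨ +-cong (≈-sym (poly≈horner num)) (-‿cong (·-cong (≈-sym (poly≈horner wc)) ≈-refl)) ⟩
    numPoly ⊖ wCoeff · W        ∎
    where
    open SetoidReasoning setoid
    den num wc : List ℤ
    den = + 0 ∷ -[1+ 1 ] ∷ + 4 ∷ + 10 ∷ + 4 ∷ []
    num = + 2 ∷ -[1+ 2 ] ∷ -[1+ 6 ] ∷ -[1+ 0 ] ∷ + 1 ∷ []
    wc  = + 2 ∷ + 3 ∷ + 1 ∷ []

mainTheorem2 : (W : Series) → W 0 ≡ 1ℚ → (∀ n → (W ⋆ W) n ≡ radicand n) →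
    ∀ n → (denPoly ⋆ P) n ≡ (numPoly ⊖ (wCoeff ⋆ W)) n
mainTheorem2 W W₀ W² = begin
  denPoly ⋆ P                    ≈⟨ ⋆≈· denPoly P ⟩
  denPoly · P                    ≈⟨ ·-congˡ denPoly P≈paths ⟩
  denPoly · paths (+ 0) neutral  ≈⟨ elimination d₀·paths≈candidate ⟩
  numPoly ⊖ wCoeff · W           ≈⟨ ⊕-congˡ numPoly (-‿cong (≈-sym (⋆≈· wCoeff W))) ⟩
  numPoly ⊖ (wCoeff ⋆ W)         ∎
  where
  open SquareRoot W W₀ W²
  open SetoidReasoning setoid
  d₀·paths≈candidate : d₀ · paths (+ 0) neutral ≈ₛ candidate (+ 0) neutral
  d₀·paths≈candidate =
    solution-unique (*-identityʳ d₀) (solution-scale d₀ paths-solution) candidate-solution (+ 0) neutral
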